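{- Let $G$ be a finite simple graph with $n$ vertices and maximum degree $\Delta(G)<n$ (i.e. any graph). Then for every natural number $k$, $$\left\lceil\frac{n}{n-D_1(G)}\right\rceil\leq\varphi^{(k)}(G)\leq\left\lceil\frac{n}{n-\Delta(G)}\right\rceil,$$ where $D_1(G)$ is the average degree of $G$.
   Context: Let $d(v)$ denote the degree of $v$. For nonempty $W\subseteq V(G)$ and natural $k$, $D_k(W)=\left(\frac{1}{|W|}\sum_{v\in W}d^k(v)\right)^{1/k}$ and $D_k(G)=D_k(V(G))$. $W$ is a $\delta_k$-small set if $D_k(W)\leq n-|W|$. $\varphi^{(k)}(G)$ is the smallest natural number $r$ such that $V(G)$ is a disjoint union of $r$ $\delta_k$-small sets. $\Delta(G)$ is the maximum degree of $G$. -}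

module Defs where

open import Data.Nat using (ℕ; zero; suc; _+_; _*_; _∸_; _^_; _≤_; _⊔_)
open import Data.Nat.DivMod using (_/_)
open import Data.Bool using (Bool; if_then_else_)
open import Data.Fin using (Fin)
open import Data.Fin.Subset using (Subset; _∈_; _∉_; ∣_∣; Nonempty)
open import Data.Vec using (lookup; tabulate)
open import Data.List using (List; map; foldr; allFin)
open import Data.Nat.ListAction using (sum)
open import Data.Product using (Σ; _×_)
open import Relation.Nullary using (does)
open import Relation.Binary.PropositionalEquality using (_≡_)
import Data.Fin as F

record Graph (n : ℕ) : Set where
  field
    adj    : Fin n → Subset n
    sym    : ∀ u v → v ∈ adj u → u ∈ adj v
    irrefl : ∀ v → v ∉ adj v
open Graph public

deg : ∀ {n} → Graph n → Fin n → ℕ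
deg G v = ∣ adj G v ∣

-- sum of all degrees (= n · D₁(G))
degSum : ∀ {n} → Graph n → ℕ
degSum {n} G = sum (map (deg G) (allFin n))

maxDeg : ∀ {n} → Graph n → ℕ
maxDeg {n} G = foldr _⊔_ 0 (map (deg G) (allFin n))

powSum : ∀ {n} → Graph n → ℕ → Subset n → ℕ
powSum {n} G k W = sum (map (λ v → if lookup W v then deg G v ^ k else 0) (allFin n))

-- W is δ_k-small: W nonempty and D_k(W) ≤ n − |W|, i.e. (raising to the k-th power
-- and multiplying by |W| > 0)  Σ_{v∈W} d(v)^k ≤ |W| · (n − |W|)^k.
Small : ∀ {n} → Graph n → ℕ → Subset n → Set
Small {n} G k W = Nonempty W × (powSum G k W ≤ ∣ W ∣ * (n ∸ ∣ W ∣) ^ k)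

block : ∀ {n r} → (Fin n → Fin r) → Fin r → Subset n
block f i = tabulate (λ v → does (f v F.≟ i))

SmallPartition : ∀ {n} → Graph n → ℕ → ℕ → Set
SmallPartition {n} G k r = Σ (Fin n → Fin r) (λ f → ∀ i → Small G k (block f i))

IsPhi : ∀ {n} → Graph n → ℕ → ℕ → Set
IsPhi G k r = SmallPartition G k r × (∀ r' → SmallPartition G k r' → r ≤ r')

-- ceiling division ⌈ a / b ⌉ (junk value 0 when b = 0)
⌈_÷_⌉ : ℕ → ℕ → ℕ
⌈ a ÷ zero ⌉ = 0
⌈ a ÷ suc b ⌉ = (a + b) / suc b

module Submission where

-- Lower bound.  Let V = W₁ ⊎ … ⊎ W_r be a partition into δ_k-small sets and
-- cᵢ = |Wᵢ|.  By the tangent-line (Bernoulli) inequality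
--   k·t^(k-1)·x ≤ x^k + (k-1)·t^k
-- a k-th power mean bounds the arithmetic mean (power-mean), so every small
-- block satisfies Σ_{v∈Wᵢ} d(v) ≤ cᵢ(n − cᵢ).  Summing over the blocks,
--   Σ_v d(v) ≤ Σᵢ cᵢ(n − cᵢ) = n² − Σᵢ cᵢ²,
-- and Cauchy–Schwarz (Σᵢ cᵢ)² ≤ r·Σᵢ cᵢ² yields n² ≤ r·(n² − Σ_v d(v)), which is
-- the ceiling bound ⌈n/(n − D₁)⌉ = ⌈n²/(n² − Σ_v d(v))⌉ ≤ r.
--
-- Upper bound.  With s = n − Δ, cut V = {0,…,n−1} into the ⌈n/s⌉ consecutive
-- intervals of length ≤ s (chunking).  A block W of size ≤ s has every degree
-- ≤ Δ ≤ n − |W|, hence is δ_k-small for every k; minimality of r concludes.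

open import Data.Nat
open import Data.Nat.Properties
open import Data.Nat.DivMod using (_/_; _%_; m≡m%n+[m/n]*n; m%n<n; m/n*n≤m; m*n/n≡m; m<n*o⇒m/o<n)
open import Data.Nat.Tactic.RingSolver using (solve-∀)
open import Data.Nat.ListAction using () renaming (sum to sumᴸ)
open import Data.Bool using (Bool; true; false; if_then_else_)
open import Data.Fin as F using (Fin; toℕ; fromℕ<)
open import Data.Fin.Properties using (toℕ<n; toℕ-fromℕ<; toℕ-fromℕ; toℕ-inject₁; toℕ-injective)
open import Data.Fin.Subset using (Subset; _∈_; Nonempty; ∣_∣)
open import Data.Fin.Subset.Properties using (∣p∣≤n)
open import Data.Vec using ([]; _∷_; lookup)
open import Data.Vec.Properties using (lookup∘tabulate; lookup⇒[]=)
open import Data.List using (map; allFin; foldr)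
import Data.List as L
open import Data.List.Properties using (map-tabulate)
open import Data.List.Relation.Unary.Any using (here; there)
import Data.List.Membership.Propositional as Mem
open import Data.List.Membership.Propositional.Properties using (∈-map⁺; ∈-allFin)
open import Data.Product using (Σ; _×_; _,_; proj₁; proj₂)
open import Data.Sum using (_⊎_; inj₁; inj₂)
open import Data.Empty using (⊥-elim)
open import Function using (_∘_)
open import Relation.Nullary using (Dec; does; yes; no)
open import Relation.Nullary.Decidable using (dec-true; dec-false)
open import Relation.Binary.PropositionalEquality
open import Algebra.Properties.Semiring.Sum +-*-semiring
  using (sum; sum-syntax; sum-cong-≗; ∑-distrib-+; ∑-comm; *-distribˡ-sum; *-distribʳ-sum; sum-init-last)
open import Defs hiding (sym)

sumᴸ-allFin : ∀ n (h : Fin n → ℕ) → sumᴸ (map h (allFin n)) ≡ ∑[ v < n ] h v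
sumᴸ-allFin n h = trans (cong sumᴸ (map-tabulate (λ v → v) h)) (sumᴸ-tabulate n h)
  where
  sumᴸ-tabulate : ∀ n (h : Fin n → ℕ) → sumᴸ (L.tabulate h) ≡ sum h
  sumᴸ-tabulate zero    h = refl
  sumᴸ-tabulate (suc n) h = cong (h F.zero +_) (sumᴸ-tabulate n (h ∘ F.suc))

∑-mono : ∀ {n} {f g : Fin n → ℕ} → (∀ i → f i ≤ g i) → sum f ≤ sum g
∑-mono {zero}  f≤g = z≤n
∑-mono {suc n} f≤g = +-mono-≤ (f≤g F.zero) (∑-mono (f≤g ∘ F.suc))

∑-const : ∀ n a → ∑[ i < n ] a ≡ n * a
∑-const zero    a = refl
∑-const (suc n) a = cong (a +_) (∑-const n a)

𝟙 : Bool → ℕ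
𝟙 true  = 1
𝟙 false = 0

mask≡𝟙* : ∀ b x → (if b then x else 0) ≡ 𝟙 b * x
mask≡𝟙* true  x = sym (+-identityʳ x)
mask≡𝟙* false x = refl

∑∈ : ∀ {n} → Subset n → (Fin n → ℕ) → ℕ
∑∈ {n} W f = ∑[ v < n ] (𝟙 (lookup W v) * f v)

∣∣≡∑𝟙 : ∀ {n} (W : Subset n) → ∣ W ∣ ≡ ∑[ v < n ] 𝟙 (lookup W v)
∣∣≡∑𝟙 []          = refl
∣∣≡∑𝟙 (true ∷ W)  = cong suc (∣∣≡∑𝟙 W)
∣∣≡∑𝟙 (false ∷ W) = ∣∣≡∑𝟙 W

∑∈-const : ∀ {n} (W : Subset n) a → ∑∈ W (λ _ → a) ≡ ∣ W ∣ * a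
∑∈-const W a = trans (sym (*-distribʳ-sum a (𝟙 ∘ lookup W))) (cong (_* a) (sym (∣∣≡∑𝟙 W)))

powSum≡∑∈ : ∀ {n} (G : Graph n) k W → powSum G k W ≡ ∑∈ W (λ v → deg G v ^ k)
powSum≡∑∈ {n} G k W =
  trans (sumᴸ-allFin n _) (sum-cong-≗ (λ v → mask≡𝟙* (lookup W v) (deg G v ^ k)))

does-≟-toℕ : ∀ {r} (x y : Fin r) → does (x F.≟ y) ≡ does (toℕ x ≟ toℕ y)
does-≟-toℕ x y with x F.≟ y
... | yes x≡y = sym (dec-true (toℕ x ≟ toℕ y) (cong toℕ x≡y))
... | no  x≢y = sym (dec-false (toℕ x ≟ toℕ y) (x≢y ∘ toℕ-injective))

does-true⇒ : ∀ {a} {A : Set a} (a? : Dec A) → does a? ≡ true → A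
does-true⇒ (yes a) _ = a

∑-point : ∀ {r} (j : Fin r) → ∑[ i < r ] 𝟙 (does (j F.≟ i)) ≡ 1
∑-point {suc r} F.zero    = cong suc (trans (∑-const r 0) (*-zeroʳ r))
∑-point {suc r} (F.suc j) = ∑-point j

∑-blocks : ∀ {n r} (f : Fin n → Fin r) (h : Fin n → ℕ) →
  ∑[ v < n ] h v ≡ ∑[ i < r ] ∑∈ (block f i) h
∑-blocks {n} {r} f h = begin
  ∑[ v < n ] h v
    ≡⟨ sum-cong-≗ (λ v → sym (trans (cong (_* h v) (∑-point (f v))) (*-identityˡ (h v)))) ⟩
  ∑[ v < n ] ((∑[ i < r ] 𝟙 (does (f v F.≟ i))) * h v)
    ≡⟨ sum-cong-≗ (λ v → *-distribʳ-sum (h v) (λ i → 𝟙 (does (f v F.≟ i)))) ⟩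
  ∑[ v < n ] ∑[ i < r ] (𝟙 (does (f v F.≟ i)) * h v)
    ≡⟨ ∑-comm (λ v i → 𝟙 (does (f v F.≟ i)) * h v) ⟩
  ∑[ i < r ] ∑[ v < n ] (𝟙 (does (f v F.≟ i)) * h v)
    ≡⟨ sum-cong-≗ (λ i → sum-cong-≗ (λ v →
         cong (λ b → 𝟙 b * h v) (sym (lookup∘tabulate (λ v → does (f v F.≟ i)) v)))) ⟩
  ∑[ i < r ] ∑∈ (block f i) h ∎
  where open ≡-Reasoning

∑-block-sizes : ∀ {n r} (f : Fin n → Fin r) → ∑[ i < r ] ∣ block f i ∣ ≡ n
∑-block-sizes {n} f = begin
  ∑[ i < _ ] ∣ block f i ∣         ≡⟨ sum-cong-≗ (λ i → trans (∑∈-const (block f i) 1) (*-identityʳ _)) ⟨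
  ∑[ i < _ ] ∑∈ (block f i) (λ _ → 1) ≡⟨ ∑-blocks f (λ _ → 1) ⟨
  ∑[ v < n ] 1                     ≡⟨ ∑-const n 1 ⟩
  n * 1                            ≡⟨ *-identityʳ n ⟩
  n ∎
  where open ≡-Reasoning

rearrangement : ∀ {a b c d} → a ≤ c → b ≤ d → a * d + c * b ≤ a * b + c * d
rearrangement {a} {b} a≤c b≤d with m≤n⇒∃[o]m+o≡n a≤c | m≤n⇒∃[o]m+o≡n b≤d
... | p , refl | q , refl =
  subst (a * (b + q) + (a + p) * b ≤_) (expand a b p q) (m≤m+n _ (p * q))
  where
  expand : ∀ a b p q → a * (b + q) + (a + p) * b + p * q ≡ a * b + (a + p) * (b + q)
  expand = solve-∀

similarly-ordered : ∀ a b c d → (a ≤ c × b ≤ d) ⊎ (c ≤ a × d ≤ b) →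
  a * d + c * b ≤ a * b + c * d
similarly-ordered a b c d (inj₁ (a≤c , b≤d)) = rearrangement a≤c b≤d
similarly-ordered a b c d (inj₂ (c≤a , d≤b)) =
  subst₂ _≤_ (+-comm (c * b) (a * d)) (+-comm (c * d) (a * b)) (rearrangement c≤a d≤b)

2ab≤a²+b² : ∀ a b → 2 * (a * b) ≤ a * a + b * b
2ab≤a²+b² a b = subst (_≤ a * a + b * b) (double a b) (similarly-ordered a a b b ordered)
  where
  double : ∀ a b → a * b + b * a ≡ 2 * (a * b)
  double = solve-∀
  ordered : (a ≤ b × a ≤ b) ⊎ (b ≤ a × b ≤ a)
  ordered with ≤-total a b
  ... | inj₁ a≤b = inj₁ (a≤b , a≤b)
  ... | inj₂ b≤a = inj₂ (b≤a , b≤a)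

-- (x^(m+1) − t^(m+1))·(x − t) ≥ 0.
power-rearrangement : ∀ m x t → x ^ suc m * t + t ^ suc m * x ≤ x ^ suc m * x + t ^ suc m * t
power-rearrangement m x t = similarly-ordered (x ^ suc m) x (t ^ suc m) t ordered
  where
  ordered : (x ^ suc m ≤ t ^ suc m × x ≤ t) ⊎ (t ^ suc m ≤ x ^ suc m × t ≤ x)
  ordered with ≤-total x t
  ... | inj₁ x≤t = inj₁ (^-monoˡ-≤ (suc m) x≤t , x≤t)
  ... | inj₂ t≤x = inj₂ (^-monoˡ-≤ (suc m) t≤x , t≤x)

tangent-line : ∀ m x t → suc m * (t ^ m * x) ≤ x ^ suc m + m * t ^ suc m
tangent-line zero    x t = ≤-reflexive (base x)
  where
  base : ∀ x → 1 * (1 * x) ≡ x * 1 + 0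
  base = solve-∀
tangent-line (suc m) x t = begin
  suc (suc m) * (t * t ^ m * x)                   ≡⟨ peel-t m x t (t ^ m) ⟩
  t * (suc m * (t ^ m * x)) + t * t ^ m * x       ≤⟨ +-monoˡ-≤ _ (*-monoʳ-≤ t (tangent-line m x t)) ⟩
  t * (x ^ suc m + m * t ^ suc m) + t * t ^ m * x ≡⟨ regroup m x t (x ^ m) (t ^ m) ⟩
  (x ^ suc m * t + t ^ suc m * x) + m * t ^ suc (suc m)
    ≤⟨ +-monoˡ-≤ _ (power-rearrangement m x t) ⟩
  (x ^ suc m * x + t ^ suc m * t) + m * t ^ suc (suc m) ≡⟨ collect m x t (x ^ m) (t ^ m) ⟩
  x ^ suc (suc m) + suc m * t ^ suc (suc m) ∎
  where
  open ≤-Reasoning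
  peel-t : ∀ m x t B → (2 + m) * (t * B * x) ≡ t * ((1 + m) * (B * x)) + t * B * x
  peel-t = solve-∀
  regroup : ∀ m x t A B → t * (x * A + m * (t * B)) + t * B * x
                   ≡ (x * A * t + t * B * x) + m * (t * (t * B))
  regroup = solve-∀
  collect : ∀ m x t A B → (x * A * x + t * B * t) + m * (t * (t * B))
                   ≡ x * (x * A) + (1 + m) * (t * (t * B))
  collect = solve-∀

-- For t = 0 use x ≤ x^(m+1); for t > 0 sum the tangent-line inequality with
-- weights w and cancel the factor (m+1)·t^m.
power-mean : ∀ {n} (w x : Fin n → ℕ) t m →
  ∑[ v < n ] (w v * x v ^ suc m) ≤ (∑[ v < n ] w v) * t ^ suc m →
  ∑[ v < n ] (w v * x v) ≤ (∑[ v < n ] w v) * t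
power-mean {n} w x zero m hyp =
  ≤-trans (∑-mono (λ v → *-monoʳ-≤ (w v) (x≤x^[1+m] (x v)))) hyp
  where
  x≤x^[1+m] : ∀ y → y ≤ y ^ suc m
  x≤x^[1+m] zero    = z≤n
  x≤x^[1+m] (suc y) = subst (_≤ suc y ^ suc m) (*-identityʳ (suc y))
                            (*-monoʳ-≤ (suc y) (m^n>0 (suc y) m))
power-mean {n} w x t@(suc _) m hyp =
  *-cancelˡ-≤ (suc m) (*-cancelˡ-≤ (t ^ m) {{m^n≢0 t m}} scaled)
  where
  open ≤-Reasoning
  W : ℕ
  W = ∑[ v < n ] w v
  scaled : t ^ m * (suc m * ∑[ v < n ] (w v * x v)) ≤ t ^ m * (suc m * (W * t))
  scaled = begin
    t ^ m * (suc m * ∑[ v < n ] (w v * x v))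
      ≡⟨ trans (cong (t ^ m *_) (*-distribˡ-sum (suc m) (λ v → w v * x v)))
               (*-distribˡ-sum (t ^ m) (λ v → suc m * (w v * x v))) ⟩
    ∑[ v < n ] (t ^ m * (suc m * (w v * x v)))
      ≡⟨ sum-cong-≗ (λ v → regroup (t ^ m) (suc m) (w v) (x v)) ⟩
    ∑[ v < n ] (w v * (suc m * (t ^ m * x v)))
      ≤⟨ ∑-mono (λ v → *-monoʳ-≤ (w v) (tangent-line m (x v) t)) ⟩
    ∑[ v < n ] (w v * (x v ^ suc m + m * t ^ suc m))
      ≡⟨ sum-cong-≗ (λ v → *-distribˡ-+ (w v) _ _) ⟩
    ∑[ v < n ] (w v * x v ^ suc m + w v * (m * t ^ suc m))
      ≡⟨ ∑-distrib-+ (λ v → w v * x v ^ suc m) (λ v → w v * (m * t ^ suc m)) ⟩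
    ∑[ v < n ] (w v * x v ^ suc m) + ∑[ v < n ] (w v * (m * t ^ suc m))
      ≡⟨ cong (_ +_) (trans (sum-cong-≗ (λ v → *-comm (w v) _)) (sym (*-distribˡ-sum (m * t ^ suc m) w))) ⟩
    ∑[ v < n ] (w v * x v ^ suc m) + m * t ^ suc m * W
      ≤⟨ +-monoˡ-≤ _ hyp ⟩
    W * t ^ suc m + m * t ^ suc m * W
      ≡⟨ collect W t (t ^ m) m ⟩
    t ^ m * (suc m * (W * t)) ∎
    where
    regroup : ∀ A k a y → A * (k * (a * y)) ≡ a * (k * (A * y))
    regroup = solve-∀
    collect : ∀ W t A m → W * (t * A) + m * (t * A) * W ≡ A * ((1 + m) * (W * t))
    collect = solve-∀

cauchy-schwarz : ∀ {r} (c : Fin r → ℕ) → sum c * sum c ≤ r * ∑[ i < r ] (c i * c i)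
cauchy-schwarz {r} c = *-cancelˡ-≤ 2 (begin
  2 * (S * S)                                      ≡⟨ twice-square ⟩
  ∑[ i < r ] ∑[ j < r ] (2 * (c i * c j))          ≤⟨ ∑-mono (λ i → ∑-mono (λ j → 2ab≤a²+b² (c i) (c j))) ⟩
  ∑[ i < r ] ∑[ j < r ] (c i * c i + c j * c j)    ≡⟨ twice-r-squares ⟩
  2 * (r * Q) ∎)
  where
  open ≤-Reasoning
  S : ℕ
  S = sum c
  Q : ℕ
  Q = ∑[ i < r ] (c i * c i)
  twice-square : 2 * (S * S) ≡ ∑[ i < r ] ∑[ j < r ] (2 * (c i * c j))
  twice-square = begin-equality
    2 * (S * S)                             ≡⟨ cong (2 *_) (*-distribʳ-sum S c) ⟩
    2 * ∑[ i < r ] (c i * S)                ≡⟨ cong (2 *_) (sum-cong-≗ (λ i → *-distribˡ-sum (c i) c)) ⟩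
    2 * ∑[ i < r ] ∑[ j < r ] (c i * c j)   ≡⟨ *-distribˡ-sum 2 (λ i → ∑[ j < r ] (c i * c j)) ⟩
    ∑[ i < r ] (2 * ∑[ j < r ] (c i * c j)) ≡⟨ sum-cong-≗ (λ i → *-distribˡ-sum 2 (λ j → c i * c j)) ⟩
    ∑[ i < r ] ∑[ j < r ] (2 * (c i * c j)) ∎
  twice-r-squares : ∑[ i < r ] ∑[ j < r ] (c i * c i + c j * c j) ≡ 2 * (r * Q)
  twice-r-squares = begin-equality
    ∑[ i < r ] ∑[ j < r ] (c i * c i + c j * c j)
      ≡⟨ sum-cong-≗ (λ i → trans (∑-distrib-+ (λ _ → c i * c i) (λ j → c j * c j))
                                 (cong (_+ Q) (∑-const r (c i * c i)))) ⟩
    ∑[ i < r ] (r * (c i * c i) + Q)          ≡⟨ ∑-distrib-+ (λ i → r * (c i * c i)) (λ _ → Q) ⟩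
    ∑[ i < r ] (r * (c i * c i)) + ∑[ i < r ] Q
      ≡⟨ cong₂ _+_ (sym (*-distribˡ-sum r (λ i → c i * c i))) (∑-const r Q) ⟩
    r * Q + r * Q                             ≡⟨ cong (r * Q +_) (sym (+-identityʳ (r * Q))) ⟩
    2 * (r * Q) ∎

⌈÷⌉≤ : ∀ {a b r} → 1 ≤ a → a ≤ r * b → ⌈ a ÷ b ⌉ ≤ r
⌈÷⌉≤ {a} {zero}  {r} 1≤a a≤0 = ⊥-elim (<⇒≱ 1≤a (≤-trans a≤0 (≤-reflexive (*-zeroʳ r))))
⌈÷⌉≤ {a} {suc b} {r} 1≤a a≤rb = s≤s⁻¹ (m<n*o⇒m/o<n (begin-strict
  a + b             ≤⟨ +-monoˡ-≤ b a≤rb ⟩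
  r * suc b + b     <⟨ n<1+n _ ⟩
  suc (r * suc b + b) ≡⟨ cong suc (+-comm (r * suc b) b) ⟩
  suc r * suc b     ∎))
  where open ≤-Reasoning

small⇒degree-sum : ∀ {n} (G : Graph n) m W → Small G (suc m) W →
  ∑∈ W (deg G) ≤ ∣ W ∣ * (n ∸ ∣ W ∣)
small⇒degree-sum {n} G m W (_ , small) =
  subst (λ c → ∑∈ W (deg G) ≤ c * t) (sym (∣∣≡∑𝟙 W))
    (power-mean (𝟙 ∘ lookup W) (deg G) t m
      (subst₂ (λ P c → P ≤ c * t ^ suc m) (powSum≡∑∈ G (suc m) W) (∣∣≡∑𝟙 W) small))
  where
  t : ℕ
  t = n ∸ ∣ W ∣

block-counting : ∀ {r} n S (c : Fin r → ℕ) → (∀ i → c i ≤ n) → sum c ≡ n →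
  S ≤ ∑[ i < r ] (c i * (n ∸ c i)) → n * n ≤ r * (n * n ∸ S)
block-counting {r} n S c c≤n ∑c≡n S≤A = begin
  n * n           ≡⟨ cong₂ _*_ ∑c≡n ∑c≡n ⟨
  sum c * sum c   ≤⟨ cauchy-schwarz c ⟩
  r * Q           ≤⟨ *-monoʳ-≤ r Q≤n²∸S ⟩
  r * (n * n ∸ S) ∎
  where
  open ≤-Reasoning
  A : ℕ
  A = ∑[ i < r ] (c i * (n ∸ c i))
  Q : ℕ
  Q = ∑[ i < r ] (c i * c i)
  A+Q≡n² : A + Q ≡ n * n
  A+Q≡n² = begin-equality
    A + Q       ≡⟨ ∑-distrib-+ (λ i → c i * (n ∸ c i)) (λ i → c i * c i) ⟨
    ∑[ i < r ] (c i * (n ∸ c i) + c i * c i)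
      ≡⟨ sum-cong-≗ (λ i → trans (sym (*-distribˡ-+ (c i) (n ∸ c i) (c i)))
                                 (cong (c i *_) (m∸n+n≡m (c≤n i)))) ⟩
    ∑[ i < r ] (c i * n) ≡⟨ *-distribʳ-sum n c ⟨
    sum c * n   ≡⟨ cong (_* n) ∑c≡n ⟩
    n * n       ∎
  Q≤n²∸S : Q ≤ n * n ∸ S
  Q≤n²∸S = begin
    Q           ≡⟨ m+n∸m≡n S Q ⟨
    S + Q ∸ S   ≤⟨ ∸-monoˡ-≤ S (+-monoˡ-≤ Q S≤A) ⟩
    A + Q ∸ S   ≡⟨ cong (_∸ S) A+Q≡n² ⟩
    n * n ∸ S   ∎

small-partition-lower-bound : ∀ {n} (G : Graph n) m r → SmallPartition G (suc m) r →
  n * n ≤ r * (n * n ∸ degSum G)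
small-partition-lower-bound {n} G m r (f , small) =
  block-counting n (degSum G) (λ i → ∣ block f i ∣) (λ i → ∣p∣≤n (block f i)) (∑-block-sizes f)
    (begin
      degSum G                          ≡⟨ sumᴸ-allFin n (deg G) ⟩
      ∑[ v < n ] deg G v                ≡⟨ ∑-blocks f (deg G) ⟩
      ∑[ i < r ] ∑∈ (block f i) (deg G) ≤⟨ ∑-mono (λ i → small⇒degree-sum G m (block f i) (small i)) ⟩
      ∑[ i < r ] (∣ block f i ∣ * (n ∸ ∣ block f i ∣)) ∎)
  where open ≤-Reasoning

∈⇒≤max : ∀ {x xs} → x Mem.∈ xs → x ≤ foldr _⊔_ 0 xs
∈⇒≤max (here refl)  = m≤m⊔n _ _
∈⇒≤max (there x∈xs) = ≤-trans (∈⇒≤max x∈xs) (m≤n⊔m _ _)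

deg≤maxDeg : ∀ {n} (G : Graph n) v → deg G v ≤ maxDeg G
deg≤maxDeg G v = ∈⇒≤max (∈-map⁺ (deg G) (∈-allFin v))

low-degree⇒small : ∀ {n} (G : Graph n) k W → Nonempty W →
  (∀ v → v ∈ W → deg G v ≤ n ∸ ∣ W ∣) → Small G k W
low-degree⇒small {n} G k W nonempty low = nonempty , (begin
  powSum G k W                 ≡⟨ powSum≡∑∈ G k W ⟩
  ∑∈ W (λ v → deg G v ^ k)     ≤⟨ ∑-mono pointwise ⟩
  ∑∈ W (λ _ → (n ∸ ∣ W ∣) ^ k) ≡⟨ ∑∈-const W _ ⟩
  ∣ W ∣ * (n ∸ ∣ W ∣) ^ k      ∎)
  where
  open ≤-Reasoning
  pointwise : ∀ v → 𝟙 (lookup W v) * deg G v ^ k ≤ 𝟙 (lookup W v) * (n ∸ ∣ W ∣) ^ k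
  pointwise v with lookup W v in v∈W
  ... | true  = +-monoˡ-≤ 0 (^-monoˡ-≤ k (low v (lookup⇒[]= v W v∈W)))
  ... | false = z≤n

division-window : ∀ x s .{{_ : NonZero s}} → x / s * s ≤ x × x < x / s * s + s
division-window x s = m/n*n≤m x s , (begin-strict
  x                 ≡⟨ m≡m%n+[m/n]*n x s ⟩
  x % s + x / s * s <⟨ +-monoˡ-< _ (m%n<n x s) ⟩
  s + x / s * s     ≡⟨ +-comm s _ ⟩
  x / s * s + s     ∎)
  where open ≤-Reasoning

window-count : ∀ (p : ℕ → Bool) a s → (∀ x → p x ≡ true → a ≤ x × x < a + s) →
  ∀ N → ∑[ x < N ] 𝟙 (p (toℕ x)) ≤ s
window-count p a s inside N = proj₂ (bounds N)
  where
  count : ℕ → ℕ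
  count N = ∑[ x < N ] 𝟙 (p (toℕ x))
  count-suc : ∀ N → count (suc N) ≡ count N + 𝟙 (p N)
  count-suc N = begin
    count (suc N)                                           ≡⟨ sum-init-last (λ x → 𝟙 (p (toℕ x))) ⟩
    ∑[ x < N ] 𝟙 (p (toℕ (F.inject₁ x))) + 𝟙 (p (toℕ (F.fromℕ N)))
      ≡⟨ cong₂ _+_ (sum-cong-≗ {N} (cong (𝟙 ∘ p) ∘ toℕ-inject₁)) (cong (𝟙 ∘ p) (toℕ-fromℕ N)) ⟩
    count N + 𝟙 (p N)                                       ∎
    where open ≡-Reasoning
  bounds : ∀ N → count N ≤ N ∸ a × count N ≤ s
  bounds zero = z≤n , z≤n
  bounds (suc N) rewrite count-suc N with p N in pN | bounds N
  ... | false | ≤N∸a , ≤s =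
    subst (λ σ → σ ≤ suc N ∸ a × σ ≤ s) (sym (+-identityʳ (count N)))
          (≤-trans ≤N∸a (∸-monoˡ-≤ a (n≤1+n N)) , ≤s)
  ... | true  | ≤N∸a , _ = ≤1+N∸a , ≤-trans ≤1+N∸a (m≤n+o⇒m∸n≤o (suc N) a (proj₂ (inside N pN)))
    where
    ≤1+N∸a : count N + 1 ≤ suc N ∸ a
    ≤1+N∸a = subst₂ _≤_ (+-comm 1 (count N)) (sym (+-∸-assoc 1 (proj₁ (inside N pN)))) (s≤s ≤N∸a)

chunking : ∀ n b → Σ (Fin n → Fin ((n + b) / suc b)) λ f →
  ∀ i → Nonempty (block f i) × ∣ block f i ∣ ≤ suc b
chunking n b = chunk , λ i → nonempty i , size i
  where
  s : ℕ
  s = suc b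
  q : ℕ
  q = (n + b) / s
  n≤q*s : n ≤ q * s
  n≤q*s = +-cancelʳ-≤ b n (q * s)
    (s≤s⁻¹ (subst (n + b <_) (+-suc (q * s) b) (proj₂ (division-window (n + b) s))))
  index< : ∀ (v : Fin n) → toℕ v / s < q
  index< v = m<n*o⇒m/o<n (≤-trans (toℕ<n v) n≤q*s)
  chunk : Fin n → Fin q
  chunk v = fromℕ< (index< v)
  member : ∀ i v → lookup (block chunk i) v ≡ does (toℕ v / s ≟ toℕ i)
  member i v = trans (lookup∘tabulate (λ v → does (chunk v F.≟ i)) v)
    (trans (does-≟-toℕ (chunk v) i) (cong (λ y → does (y ≟ toℕ i)) (toℕ-fromℕ< (index< v))))
  size : ∀ i → ∣ block chunk i ∣ ≤ s
  size i = subst (_≤ s) (sym (trans (∣∣≡∑𝟙 (block chunk i)) (sum-cong-≗ (λ v → cong 𝟙 (member i v)))))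
    (window-count (λ x → does (x / s ≟ toℕ i)) (toℕ i * s) s inside n)
    where
    inside : ∀ x → does (x / s ≟ toℕ i) ≡ true → toℕ i * s ≤ x × x < toℕ i * s + s
    inside x chosen = subst (λ y → y * s ≤ x × x < y * s + s) (does-true⇒ (x / s ≟ toℕ i) chosen)
                            (division-window x s)
  nonempty : ∀ i → Nonempty (block chunk i)
  nonempty i = fromℕ< i*s<n , lookup⇒[]= (fromℕ< i*s<n) (block chunk i)
    (trans (member i (fromℕ< i*s<n))
      (trans (cong (λ y → does (y / s ≟ toℕ i)) (toℕ-fromℕ< i*s<n))
             (dec-true (toℕ i * s / s ≟ toℕ i) (m*n/n≡m (toℕ i) s))))
    where
    i*s<n : toℕ i * s < n
    i*s<n = +-cancelˡ-≤ b (suc (toℕ i * s)) n (begin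
      b + suc (toℕ i * s) ≡⟨ +-suc b _ ⟩
      suc (toℕ i) * s     ≤⟨ *-monoˡ-≤ s (toℕ<n i) ⟩
      q * s               ≤⟨ m/n*n≤m (n + b) s ⟩
      n + b               ≡⟨ +-comm n b ⟩
      b + n               ∎)
      where open ≤-Reasoning

max-degree-partition : ∀ {n} (G : Graph n) k → maxDeg G < n →
  SmallPartition G k ⌈ n ÷ n ∸ maxDeg G ⌉
max-degree-partition {n} G k Δ<n with n ∸ maxDeg G in n∸Δ≡
... | zero  = ⊥-elim (<⇒≱ Δ<n (m∸n≡0⇒m≤n n∸Δ≡))
... | suc b = f , λ i → low-degree⇒small G k (block f i) (proj₁ (blocks i)) (λ v _ → deg≤ i v)
  where
  f : Fin n → Fin ((n + b) / suc b)
  f = proj₁ (chunking n b)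
  blocks : ∀ i → Nonempty (block f i) × ∣ block f i ∣ ≤ suc b
  blocks = proj₂ (chunking n b)
  deg≤ : ∀ i v → deg G v ≤ n ∸ ∣ block f i ∣
  deg≤ i v = begin
    deg G v           ≤⟨ deg≤maxDeg G v ⟩
    maxDeg G          ≡⟨ trans (sym (m∸[m∸n]≡n (<⇒≤ Δ<n))) (cong (n ∸_) n∸Δ≡) ⟩
    n ∸ suc b         ≤⟨ ∸-monoʳ-≤ n (proj₂ (blocks i)) ⟩
    n ∸ ∣ block f i ∣ ∎
    where open ≤-Reasoning

proposition1p5 : ∀ (n : ℕ) → 1 ≤ n → (G : Graph n) → maxDeg G < n →
    ∀ (k : ℕ) → 1 ≤ k → ∀ (r : ℕ) → IsPhi G k r →
    (⌈ n * n ÷ n * n ∸ degSum G ⌉ ≤ r) × (r ≤ ⌈ n ÷ n ∸ maxDeg G ⌉)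
proposition1p5 n 1≤n G Δ<n (suc m) _ r (partition , minimal) =
  ⌈÷⌉≤ (*-mono-≤ 1≤n 1≤n) (small-partition-lower-bound G m r partition) ,
  minimal _ (max-degree-partition G (suc m) Δ<n)
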